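{- Let $s<t$ be relatively prime positive integers. If $a<b$ are positive integers, then $w(\overline{\{a\}})\le w(\overline{\{b\}})$ and $h(\overline{\{a\}})\le h(\overline{\{b\}})$. Furthermore, for every integer $w$ with $1\le w\le s$ there exists a delta-set $\Delta$ with $w(\Delta)=w$, and for every integer $h$ with $1\le h\le t$ there exists a delta-set $\Delta$ with $h(\Delta)=h$.
   Context: The $(s,t)$-closure of a set $\beta$ of positive integers is $\overline{\beta}=\{x-as-bt: x\in\beta,\ a,b\ge0,\ x>as+bt\}$. A delta-set is a set $\overline{\{g\}}$ with $g$ a positive integer. For a finite set $\beta$ of positive integers, the width $w(\beta)$ is the number of distinct residue classes modulo $s$ represented by its elements, and the height $h(\beta)$ is the number of distinct residue classes modulo $t$ represented by its elements. -}

module Defs where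

open import Data.Nat using (ℕ; zero; suc; _+_; _*_; _∸_; _<_; _<?_; _≟_; NonZero)
open import Data.Nat.DivMod using (_%_)
open import Data.List using (List; []; _∷_; upTo; concatMap; length; filter)
open import Data.List.Relation.Unary.Any using (any?)
open import Relation.Nullary using (yes; no)

-- The (s,t)-closure of a finite set β of positive integers (given as a list;
-- the result is a list possibly with repetitions, representing the set
-- { x - a s - b t : x ∈ β, a,b ≥ 0, x > a s + b t }).
-- For positive s,t, any admissible a,b satisfy a,b ≤ x, so enumerating
-- a,b ∈ {0,…,x} is exhaustive.
closureOf : ℕ → ℕ → ℕ → List ℕ
closureOf s t x =
  concatMap (λ a → concatMap (λ b → step a b) (upTo (suc x))) (upTo (suc x))
  where
  step : ℕ → ℕ → List ℕ
  step a b with (a * s + b * t) <? x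
  ... | yes _ = (x ∸ (a * s + b * t)) ∷ []
  ... | no  _ = []

closure : ℕ → ℕ → List ℕ → List ℕ
closure s t β = concatMap (closureOf s t) β

delta : ℕ → ℕ → ℕ → List ℕ
delta s t g = closure s t (g ∷ [])

numClasses : (m : ℕ) → .{{_ : NonZero m}} → List ℕ → ℕ
numClasses m β = length (filter (λ r → any? (λ y → (y % m) ≟ r) β) (upTo m))

width : (s : ℕ) → .{{_ : NonZero s}} → List ℕ → ℕ
width s β = numClasses s β

height : (t : ℕ) → .{{_ : NonZero t}} → List ℕ → ℕ
height t β = numClasses t β

-- An element g ∸ (a s + b t) of Δ(g) is ≡ g ∸ b t (mod s), and b runs exactly
-- over the c with c t < g, i.e. over c < ⌈g/t⌉. As t is invertible mod s, the
-- residues of g ∸ c t are pairwise distinct for c < s and have period s in c,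
-- so w(Δ(g)) = min(s, ⌈g/t⌉); symmetrically h(Δ(g)) = min(t, ⌈g/s⌉). Both are
-- monotone in g, and g = (w − 1) t + 1 has width w.
module Submission where

open import Defs
open import Data.Nat
  using (ℕ; suc; _+_; _*_; _∸_; _<_; _≤_; _<?_; _⊓_; z≤n; s≤s; ≤-pred; NonZero; >-nonZero)
open import Data.Nat.Properties
open import Data.Nat.DivMod
open import Data.Nat.Divisibility using (_∣_; divides; ∣m+n∣m⇒∣n; ∣⇒≤)
open import Data.Nat.Coprimality using (Coprime)
import Data.Nat.Coprimality as Coprimality
open import Data.List using (List; upTo; applyUpTo; concatMap; length; filter)
open import Data.List.Properties using (length-applyUpTo; filter-≐)
open import Data.List.Membership.Propositional using (_∈_; find; lose)
open import Data.List.Membership.Propositional.Properties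
open import Data.List.Membership.Propositional.Properties.WithK using (unique∧set⇒bag)
open import Data.List.Relation.Binary.BagAndSetEquality using (∼bag⇒↭)
open import Data.List.Relation.Binary.Permutation.Propositional.Properties using (↭-length)
open import Data.List.Relation.Binary.Subset.Propositional using (_⊆_)
open import Data.List.Relation.Binary.Subset.Propositional.Properties using (Any-resp-⊆)
open import Data.List.Relation.Unary.Any using (Any; here)
open import Data.List.Relation.Unary.Unique.Propositional using (Unique)
import Data.List.Relation.Unary.Unique.Propositional.Properties as Unique
open import Data.Sum using (inj₁)
open import Data.Product using (Σ; ∃; _×_; _,_; proj₁)
open import Function.Bundles using (_⇔_; mk⇔; Equivalence)
open import Relation.Nullary using (yes; no; contradiction)
open import Relation.Binary.PropositionalEquality
  using (_≡_; refl; sym; trans; cong; subst; subst₂; _≢_; module ≡-Reasoning)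

m*n≤o⇔m≤o/n : ∀ m n o .{{_ : NonZero n}} → m * n ≤ o ⇔ m ≤ o / n
m*n≤o⇔m≤o/n m n o = mk⇔
  (λ mn≤o → subst (_≤ o / n) (m*n/n≡m m n) (/-monoˡ-≤ n mn≤o))
  (λ m≤o/n → ≤-trans (*-monoˡ-≤ n m≤o/n) (m/n*n≤m o n))

[o∸[u+k*m]]%m≡[o∸u]%m : ∀ o u k m .{{_ : NonZero m}} → u + k * m ≤ o →
  (o ∸ (u + k * m)) % m ≡ (o ∸ u) % m
[o∸[u+k*m]]%m≡[o∸u]%m o u k m u+km≤o = begin
  (o ∸ (u + k * m)) % m ≡⟨ cong (_% m) (∸-+-assoc o u (k * m)) ⟨
  (o ∸ u ∸ k * m) % m   ≡⟨ m*n≤o⇒[o∸m*n]%n≡o%n k km≤o∸u ⟩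
  (o ∸ u) % m           ∎
  where
  open ≡-Reasoning
  km≤o∸u : k * m ≤ o ∸ u
  km≤o∸u = m+n≤o⇒m≤o∸n (k * m) (subst (_≤ o) (+-comm u (k * m)) u+km≤o)

[m+n]%d≡m%d⇒d∣n : ∀ m n d .{{_ : NonZero d}} → (m + n) % d ≡ m % d → d ∣ n
[m+n]%d≡m%d⇒d∣n m n d eq =
  ∣m+n∣m⇒∣n (divides ((m + n) / d) quotients) (divides (m / d) refl)
  where
  open ≡-Reasoning
  quotients : m / d * d + n ≡ (m + n) / d * d
  quotients = +-cancelˡ-≡ (m % d) _ _ (begin
    m % d + (m / d * d + n)   ≡⟨ +-assoc (m % d) _ n ⟨
    m % d + m / d * d + n     ≡⟨ cong (_+ n) (m≡m%n+[m/n]*n m d) ⟨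
    m + n                     ≡⟨ m≡m%n+[m/n]*n (m + n) d ⟩
    (m + n) % d + (m + n) / d * d ≡⟨ cong (_+ (m + n) / d * d) eq ⟩
    m % d + (m + n) / d * d   ∎)

length-unique-⇔ : {A : Set} {xs ys : List A} → Unique xs → Unique ys →
  (∀ {z} → z ∈ xs ⇔ z ∈ ys) → length xs ≡ length ys
length-unique-⇔ xs! ys! xs⇔ys = ↭-length (∼bag⇒↭ (unique∧set⇒bag xs! ys! xs⇔ys))

numClasses-≡-length : ∀ m .{{_ : NonZero m}} β {rs : List ℕ} → Unique rs →
  (∀ {r} → r ∈ rs ⇔ (r < m × Any (λ y → y % m ≡ r) β)) →
  numClasses m β ≡ length rs
numClasses-≡-length m β rs! rs⇔ =
  length-unique-⇔ (Unique.filter⁺ _ (Unique.upTo⁺ m)) rs! (mk⇔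
    (λ r∈ → let r∈upTo , hit = ∈-filter⁻ _ r∈ in Equivalence.from rs⇔ (∈-upTo⁻ r∈upTo , hit))
    (λ r∈rs → let r<m , hit = Equivalence.to rs⇔ r∈rs in ∈-filter⁺ _ (∈-upTo⁺ r<m) hit))

numClasses-cong : ∀ m .{{_ : NonZero m}} {β γ : List ℕ} → β ⊆ γ → γ ⊆ β →
  numClasses m β ≡ numClasses m γ
numClasses-cong m β⊆γ γ⊆β =
  cong length (filter-≐ _ _ (Any-resp-⊆ β⊆γ , Any-resp-⊆ γ⊆β) (upTo m))

-- The local function of closureOf is out of scope; unification recovers it.
closureOf-unfold : ∀ s t x → Σ (ℕ → ℕ → List ℕ) λ step →
  closureOf s t x ≡ concatMap (λ a → concatMap (step a) (upTo (suc x))) (upTo (suc x))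
closureOf-unfold s t x = _ , refl

∈-closureOf⁺ : ∀ s t x {a b} → a < suc x → b < suc x → a * s + b * t < x →
  x ∸ (a * s + b * t) ∈ closureOf s t x
∈-closureOf⁺ s t x {a} {b} a≤x b≤x as+bt<x =
  ∈-concatMap⁺ _ (lose (∈-upTo⁺ a≤x) (∈-concatMap⁺ _ (lose (∈-upTo⁺ b≤x) step-hit)))
  where
  step-hit : x ∸ (a * s + b * t) ∈ proj₁ (closureOf-unfold s t x) a b
  step-hit with a * s + b * t <? x
  ... | yes _     = here refl
  ... | no  ≮x    = contradiction as+bt<x ≮x

∈-closureOf⁻ : ∀ s t x {y} → y ∈ closureOf s t x →
  ∃ λ a → ∃ λ b → a * s + b * t < x × y ≡ x ∸ (a * s + b * t)
∈-closureOf⁻ s t x y∈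
  with a , _ , y∈a ← find (∈-concatMap⁻ _ {xs = upTo (suc x)} y∈)
  with b , _ , y∈ab ← find (∈-concatMap⁻ _ {xs = upTo (suc x)} y∈a)
  with a * s + b * t <? x | y∈ab
... | yes as+bt<x | here y≡ = a , b , as+bt<x , y≡

∈-delta⁺ : ∀ s t g .{{_ : NonZero s}} .{{_ : NonZero t}} {a b} → a * s + b * t < g →
  g ∸ (a * s + b * t) ∈ delta s t g
∈-delta⁺ s t g {a} {b} as+bt<g = ∈-++⁺ˡ (∈-closureOf⁺ s t g
  (s≤s (≤-trans (m≤m*n a s) (m+n≤o⇒m≤o (a * s) (<⇒≤ as+bt<g))))
  (s≤s (≤-trans (m≤m*n b t) (m+n≤o⇒n≤o (a * s) (<⇒≤ as+bt<g))))
  as+bt<g)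

∈-delta⁻ : ∀ s t g {y} → y ∈ delta s t g →
  ∃ λ a → ∃ λ b → a * s + b * t < g × y ≡ g ∸ (a * s + b * t)
∈-delta⁻ s t g y∈ with ∈-++⁻ (closureOf s t g) y∈
... | inj₁ y∈closure = ∈-closureOf⁻ s t g y∈closure

delta-comm : ∀ s t g .{{_ : NonZero s}} .{{_ : NonZero t}} → delta s t g ⊆ delta t s g
delta-comm s t g y∈ with a , b , as+bt<g , refl ← ∈-delta⁻ s t g y∈
  = subst (_∈ delta t s g) (cong (g ∸_) (+-comm (b * t) (a * s)))
      (∈-delta⁺ t s g {b} {a} (subst (_< g) (+-comm (a * s) (b * t)) as+bt<g))

module Residues (m n : ℕ) .{{_ : NonZero m}} .{{_ : NonZero n}} (x : ℕ) where

  g : ℕ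
  g = suc x

  residue : ℕ → ℕ
  residue c = (g ∸ c * n) % m

  -- The residue of g ∸ (a m + b n) is residue b, so only the multiples of n matter.
  Attained : ℕ → Set
  Attained r = ∃ λ c → c * n < g × residue c ≡ r

  -- suc (x / n) = ⌈g / n⌉ is the number of c with c n < g.
  classCount : ℕ
  classCount = m ⊓ suc (x / n)

  *n<g⇔<1+x/n : ∀ c → c * n < g ⇔ c < suc (x / n)
  *n<g⇔<1+x/n c = mk⇔
    (λ cn<g → s≤s (Equivalence.to (m*n≤o⇔m≤o/n c n x) (≤-pred cn<g)))
    (λ c<k → s≤s (Equivalence.from (m*n≤o⇔m≤o/n c n x) (≤-pred c<k)))

  delta-residue⇔Attained : ∀ r → Any (λ y → y % m ≡ r) (delta m n g) ⇔ Attained r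
  delta-residue⇔Attained r = mk⇔ to from
    where
    to : Any (λ y → y % m ≡ r) (delta m n g) → Attained r
    to hit with y , y∈ , y%m≡r ← find hit
               with a , b , am+bn<g , refl ← ∈-delta⁻ m n g y∈ =
      b , ≤-<-trans (m≤n+m (b * n) (a * m)) am+bn<g , (begin
        (g ∸ b * n) % m             ≡⟨ [o∸[u+k*m]]%m≡[o∸u]%m g (b * n) a m bn+am≤g ⟨
        (g ∸ (b * n + a * m)) % m   ≡⟨ cong (λ u → (g ∸ u) % m) (+-comm (b * n) (a * m)) ⟩
        (g ∸ (a * m + b * n)) % m   ≡⟨ y%m≡r ⟩
        r                           ∎)
      where
      open ≡-Reasoning
      bn+am≤g : b * n + a * m ≤ g
      bn+am≤g = subst (_≤ g) (+-comm (a * m) (b * n)) (<⇒≤ am+bn<g)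
    from : Attained r → Any (λ y → y % m ≡ r) (delta m n g)
    from (c , cn<g , residue≡r) = lose (∈-delta⁺ m n g {0} {c} cn<g) residue≡r

  residue-% : ∀ c → c * n < g → residue (c % m) ≡ residue c
  residue-% c cn<g = begin
    (g ∸ c % m * n) % m                    ≡⟨ [o∸[u+k*m]]%m≡[o∸u]%m g _ (c / m * n) m split≤g ⟨
    (g ∸ (c % m * n + c / m * n * m)) % m  ≡⟨ cong (λ u → (g ∸ u) % m) cn≡ ⟨
    (g ∸ c * n) % m                        ∎
    where
    open ≡-Reasoning
    cn≡ : c * n ≡ c % m * n + c / m * n * m
    cn≡ = begin
      c * n                         ≡⟨ cong (_* n) (m≡m%n+[m/n]*n c m) ⟩
      (c % m + c / m * m) * n       ≡⟨ *-distribʳ-+ n (c % m) (c / m * m) ⟩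
      c % m * n + c / m * m * n     ≡⟨ cong (c % m * n +_) (*-assoc (c / m) m n) ⟩
      c % m * n + c / m * (m * n)   ≡⟨ cong (λ u → c % m * n + c / m * u) (*-comm m n) ⟩
      c % m * n + c / m * (n * m)   ≡⟨ cong (c % m * n +_) (*-assoc (c / m) n m) ⟨
      c % m * n + c / m * n * m     ∎
    split≤g : c % m * n + c / m * n * m ≤ g
    split≤g = subst (_≤ g) cn≡ (<⇒≤ cn<g)

  residue-injective : Coprime m n → ∀ {i j} → i < j → j < m → j * n < g → residue i ≢ residue j
  residue-injective coprime {i} {j} i<j j<m jn<g residue-i≡j =
    <⇒≱ (≤-<-trans (m∸n≤m j i) j<m) (∣⇒≤ {{>-nonZero (m<n⇒0<n∸m i<j)}} m∣j∸i)
    where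
    open ≡-Reasoning
    split : g ∸ i * n ≡ (g ∸ j * n) + (j ∸ i) * n
    split = begin
      g ∸ i * n                       ≡⟨ cong (_∸ i * n) (m∸n+n≡m (<⇒≤ jn<g)) ⟨
      (g ∸ j * n) + j * n ∸ i * n     ≡⟨ +-∸-assoc (g ∸ j * n) (*-monoˡ-≤ n (<⇒≤ i<j)) ⟩
      (g ∸ j * n) + (j * n ∸ i * n)   ≡⟨ cong ((g ∸ j * n) +_) (*-distribʳ-∸ n j i) ⟨
      (g ∸ j * n) + (j ∸ i) * n       ∎
    m∣j∸i : m ∣ j ∸ i
    m∣j∸i = Coprimality.coprime-divisor coprime (subst (m ∣_) (*-comm (j ∸ i) n)
      ([m+n]%d≡m%d⇒d∣n (g ∸ j * n) ((j ∸ i) * n) m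
        (trans (cong (_% m) (sym split)) residue-i≡j)))

  residues : List ℕ
  residues = applyUpTo residue classCount

  residues-unique : Coprime m n → Unique residues
  residues-unique coprime = Unique.applyUpTo⁺₁ residue classCount λ i<j j<classCount →
    residue-injective coprime i<j (<-≤-trans j<classCount (m⊓n≤m m _))
      (Equivalence.from (*n<g⇔<1+x/n _) (<-≤-trans j<classCount (m⊓n≤n m _)))

  ∈-residues⇔ : ∀ {r} → r ∈ residues ⇔ (r < m × Any (λ y → y % m ≡ r) (delta m n g))
  ∈-residues⇔ {r} = mk⇔ to from
    where
    to : r ∈ residues → r < m × Any (λ y → y % m ≡ r) (delta m n g)
    to r∈ with c , c<classCount , refl ← ∈-applyUpTo⁻ residue r∈ =
      m%n<n _ m , Equivalence.from (delta-residue⇔Attained r)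
        (c , Equivalence.from (*n<g⇔<1+x/n c) (<-≤-trans c<classCount (m⊓n≤n m _)) , refl)
    from : r < m × Any (λ y → y % m ≡ r) (delta m n g) → r ∈ residues
    from (_ , hit) with c , cn<g , refl ← Equivalence.to (delta-residue⇔Attained r) hit =
      subst (_∈ residues) (residue-% c cn<g) (∈-applyUpTo⁺ residue c%m<classCount)
      where
      c%m<classCount : c % m < classCount
      c%m<classCount = ⊓-glb (m%n<n c m)
        (≤-<-trans (m%n≤m c m) (Equivalence.to (*n<g⇔<1+x/n c) cn<g))

  numClasses-delta : Coprime m n → numClasses m (delta m n g) ≡ classCount
  numClasses-delta coprime = trans
    (numClasses-≡-length m (delta m n g) (residues-unique coprime) ∈-residues⇔)
    (length-applyUpTo residue classCount)

numClasses-delta-comm : ∀ m s t g .{{_ : NonZero m}} .{{_ : NonZero s}} .{{_ : NonZero t}} →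
  numClasses m (delta s t g) ≡ numClasses m (delta t s g)
numClasses-delta-comm m s t g = numClasses-cong m (delta-comm s t g) (delta-comm t s g)

numClasses-delta-mono : ∀ {m n} .{{_ : NonZero m}} .{{_ : NonZero n}} → Coprime m n →
  ∀ {x y} → x ≤ y → numClasses m (delta m n (suc x)) ≤ numClasses m (delta m n (suc y))
numClasses-delta-mono {m} {n} coprime {x} {y} x≤y = begin
  numClasses m (delta m n (suc x)) ≡⟨ Residues.numClasses-delta m n x coprime ⟩
  m ⊓ suc (x / n)                  ≤⟨ ⊓-monoʳ-≤ m (s≤s (/-monoˡ-≤ n x≤y)) ⟩
  m ⊓ suc (y / n)                  ≡⟨ Residues.numClasses-delta m n y coprime ⟨
  numClasses m (delta m n (suc y)) ∎
  where open ≤-Reasoning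

numClasses-delta-exact : ∀ {m n} .{{_ : NonZero m}} .{{_ : NonZero n}} → Coprime m n →
  ∀ {p} → p < m → numClasses m (delta m n (suc (p * n))) ≡ suc p
numClasses-delta-exact {m} {n} coprime {p} p<m = begin
  numClasses m (delta m n (suc (p * n))) ≡⟨ Residues.numClasses-delta m n (p * n) coprime ⟩
  m ⊓ suc (p * n / n)                    ≡⟨ cong (λ q → m ⊓ suc q) (m*n/n≡m p n) ⟩
  m ⊓ suc p                              ≡⟨ m≥n⇒m⊓n≡n p<m ⟩
  suc p                                  ∎
  where open ≡-Reasoning

lemma5p3 : (s t : ℕ) → .{{_ : NonZero s}} → .{{_ : NonZero t}} →
    s < t → Coprime s t →
    ((a b : ℕ) → 1 ≤ a → a < b →
    width s (delta s t a) ≤ width s (delta s t b)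
    × height t (delta s t a) ≤ height t (delta s t b))
    × ((w : ℕ) → 1 ≤ w → w ≤ s →
    ∃ λ g → 1 ≤ g × width s (delta s t g) ≡ w)
    × ((h : ℕ) → 1 ≤ h → h ≤ t →
    ∃ λ g → 1 ≤ g × height t (delta s t g) ≡ h)
lemma5p3 s t _ coprime = monotone , widths , heights
  where
  coprime′ : Coprime t s
  coprime′ = Coprimality.sym coprime
  monotone : (a b : ℕ) → 1 ≤ a → a < b →
    width s (delta s t a) ≤ width s (delta s t b)
    × height t (delta s t a) ≤ height t (delta s t b)
  monotone (suc x) (suc y) _ (s≤s x<y) =
    numClasses-delta-mono coprime (<⇒≤ x<y) ,
    subst₂ _≤_ (sym (numClasses-delta-comm t s t (suc x)))
               (sym (numClasses-delta-comm t s t (suc y)))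
      (numClasses-delta-mono coprime′ {x} {y} (<⇒≤ x<y))
  widths : (w : ℕ) → 1 ≤ w → w ≤ s → ∃ λ g → 1 ≤ g × width s (delta s t g) ≡ w
  widths (suc p) _ p<s = suc (p * t) , s≤s z≤n , numClasses-delta-exact coprime p<s
  heights : (h : ℕ) → 1 ≤ h → h ≤ t → ∃ λ g → 1 ≤ g × height t (delta s t g) ≡ h
  heights (suc p) _ p<t = suc (p * s) , s≤s z≤n ,
    trans (numClasses-delta-comm t s t (suc (p * s))) (numClasses-delta-exact coprime′ p<t)
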